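{- Let $a$ be a real number and let $\{a_n\}_{n\ge0}$, $\{b_n\}_{n\ge0}$ be sequences of (real or complex) numbers. Then $$b_n=a\sum_{k=0}^{\lfloor n/2\rfloor}\binom n{2k}a_{n-2k}+(1-a)a_n\quad(n=0,1,2,\ldots)$$ if and only if $$a_n=\sum_{k=0}^{\lfloor n/2\rfloor}\binom n{2k}E_{2k,a}b_{n-2k}\quad(n=0,1,2,\ldots).$$
   Context: For a real number $a$, the sequence $\{E_{n,a}\}$ is defined by $E_{0,a}=1$ and $E_{n,a}=-a\sum_{k=1}^{\lfloor n/2\rfloor}\binom{n}{2k}E_{n-2k,a}$ for $n\ge 1$. -}

module Defs where

open import Level using (Level)
open import Data.Nat using (ℕ; zero; suc; _∸_; _*_; ⌊_/2⌋)
open import Data.Nat.Combinatorics using (_C_)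
open import Data.List using (List; []; _∷_)
open import Algebra.Bundles using (CommutativeRing)

module _ {c ℓ : Level} (R : CommutativeRing c ℓ) where
  open CommutativeRing R renaming (_*_ to _·_)

  fromℕ : ℕ → Carrier
  fromℕ zero = 0#
  fromℕ (suc m) = 1# + fromℕ m

  sum1 : ℕ → (ℕ → Carrier) → Carrier
  sum1 zero f = 0#
  sum1 (suc m) f = sum1 m f + f (suc m)

  sum0 : ℕ → (ℕ → Carrier) → Carrier
  sum0 m f = f 0 + sum1 m f

  binom : ℕ → ℕ → Carrier
  binom n k = fromℕ (n C k)

  at : List Carrier → ℕ → Carrier
  at [] _ = 0#
  at (x ∷ xs) zero = x
  at (x ∷ xs) (suc i) = at xs i

  -- Etab a n = [E_{n,a}, E_{n-1,a}, ..., E_{0,a}]  (course-of-values table)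
  -- E_{0,a} = 1,  E_{n,a} = -a Σ_{k=1}^{⌊n/2⌋} C(n,2k) E_{n-2k,a};
  -- in the table Etab a n, E_{j} sits at position n ∸ j, so E_{(n+1)-2k} is at 2k ∸ 1.
  Etab : Carrier → ℕ → List Carrier
  Etab a zero = 1# ∷ []
  Etab a (suc n) =
    ((- a) · sum1 ⌊ suc n /2⌋ (λ k → binom (suc n) (2 * k) · at (Etab a n) ((2 * k) ∸ 1)))
    ∷ Etab a n

  E : Carrier → ℕ → Carrier
  E a n = at (Etab a n) 0

-- Read (aₙ) and (bₙ) as coefficients of exponential generating functions A and B. The first
-- relation says B = (a cosh t + 1 − a) A, the second A = (Σₙ E_{n,a} tⁿ/n!) B, and the recursion
-- defining E_{n,a} says exactly that these two series are mutually inverse. Over any commutative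
-- ring the product of such series is the binomial convolution ⋆, whose commutativity and
-- associativity follow by induction from the Leibniz rule (f ⋆ g)′ = f′ ⋆ g + f ⋆ g′.
module Submission where

open import Defs
open import Algebra.Bundles using (CommutativeRing)
import Algebra.Properties.CommutativeSemigroup as CommutativeSemigroupProperties
open import Data.Nat as ℕ using (ℕ; zero; suc; _∸_; _*_; ⌊_/2⌋; _≤_; _<_; z≤n; s≤s; s≤s⁻¹)
import Data.Nat.Properties as ℕ
open import Data.Nat.Combinatorics using (_C_; nCk+nC[k+1]≡[n+1]C[k+1]; k>n⇒nCk≡0)
open import Function.Bundles using (_⇔_; mk⇔; Equivalence)
open import Relation.Binary.PropositionalEquality as ≡ using (_≡_)
import Relation.Binary.Reasoning.Setoid as SetoidReasoning

k≤⌊n/2⌋⇒2*k≤n : ∀ n k → k ≤ ⌊ n /2⌋ → 2 * k ≤ n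
k≤⌊n/2⌋⇒2*k≤n n             zero    _        = z≤n
k≤⌊n/2⌋⇒2*k≤n (suc (suc n)) (suc k) (s≤s le) rewrite ℕ.*-suc 2 k = s≤s (s≤s (k≤⌊n/2⌋⇒2*k≤n n k le))

module _ {c ℓ} (R : CommutativeRing c ℓ) where
  open CommutativeRing R renaming (_*_ to _·_)
  open SetoidReasoning setoid
  open CommutativeSemigroupProperties +-commutativeSemigroup
    using (interchange) renaming (x∙yz≈y∙xz to x+[y+z]≈y+[x+z]; xy∙z≈zx∙y to [x+y]+z≈[z+x]+y)
  open CommutativeSemigroupProperties *-commutativeSemigroup using (x∙yz≈y∙xz)

  Seq : Set c
  Seq = ℕ → Carrier

  infix 4 _≋_
  _≋_ : Seq → Seq → Set ℓ
  f ≋ g = ∀ n → f n ≈ g n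

  Σ< : ℕ → Seq → Carrier
  Σ< zero    f = 0#
  Σ< (suc n) f = Σ< n f + f n

  Σ<-cong : ∀ n {f g} → (∀ i → i < n → f i ≈ g i) → Σ< n f ≈ Σ< n g
  Σ<-cong zero    f≈g = refl
  Σ<-cong (suc n) f≈g = +-cong (Σ<-cong n (λ i i<n → f≈g i (ℕ.m<n⇒m<1+n i<n))) (f≈g n (ℕ.n<1+n n))

  Σ<-distrib-+ : ∀ n f g → Σ< n (λ i → f i + g i) ≈ Σ< n f + Σ< n g
  Σ<-distrib-+ zero    f g = sym (+-identityˡ 0#)
  Σ<-distrib-+ (suc n) f g = trans (+-cong (Σ<-distrib-+ n f g) refl) (interchange _ _ _ _)

  *-distribˡ-Σ< : ∀ n x f → x · Σ< n f ≈ Σ< n (λ i → x · f i)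
  *-distribˡ-Σ< zero    x f = zeroʳ x
  *-distribˡ-Σ< (suc n) x f = trans (distribˡ x _ _) (+-cong (*-distribˡ-Σ< n x f) refl)

  Σ<-zero : ∀ n → Σ< n (λ _ → 0#) ≈ 0#
  Σ<-zero zero    = refl
  Σ<-zero (suc n) = trans (+-identityʳ _) (Σ<-zero n)

  Σ<-suc : ∀ n f → Σ< (suc n) f ≈ f 0 + Σ< n (λ i → f (suc i))
  Σ<-suc zero    f = trans (+-identityˡ _) (sym (+-identityʳ _))
  Σ<-suc (suc n) f = trans (+-cong (Σ<-suc n f) refl) (+-assoc _ _ _)

  sum1-cong : ∀ m {f g} → (∀ k → k < m → f (suc k) ≈ g (suc k)) → sum1 R m f ≈ sum1 R m g
  sum1-cong zero    f≈g = refl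
  sum1-cong (suc m) f≈g = +-cong (sum1-cong m (λ k k<m → f≈g k (ℕ.m<n⇒m<1+n k<m))) (f≈g m (ℕ.n<1+n m))

  *-distribˡ-sum1 : ∀ m x f → x · sum1 R m f ≈ sum1 R m (λ k → x · f k)
  *-distribˡ-sum1 zero    x f = zeroʳ x
  *-distribˡ-sum1 (suc m) x f = trans (distribˡ x _ _) (+-cong (*-distribˡ-sum1 m x f) refl)

  sum1≈Σ< : ∀ m f → sum1 R m f ≈ Σ< m (λ k → f (suc k))
  sum1≈Σ< zero    f = refl
  sum1≈Σ< (suc m) f = +-cong (sum1≈Σ< m f) refl

  sum0≈Σ< : ∀ m f → sum0 R m f ≈ Σ< (suc m) f
  sum0≈Σ< m f = trans (+-cong refl (sum1≈Σ< m f)) (sym (Σ<-suc m f))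

  fromℕ-+ : ∀ m n → fromℕ R (m ℕ.+ n) ≈ fromℕ R m + fromℕ R n
  fromℕ-+ zero    n = sym (+-identityˡ _)
  fromℕ-+ (suc m) n = trans (+-cong refl (fromℕ-+ m n)) (sym (+-assoc _ _ _))

  binom-pascal : ∀ n k → binom R (suc n) (suc k) ≈ binom R n k + binom R n (suc k)
  binom-pascal n k = trans (reflexive (≡.cong (fromℕ R) (≡.sym (nCk+nC[k+1]≡[n+1]C[k+1] n k))))
                           (fromℕ-+ (n C k) (n C suc k))

  binom[n,1+n]≈0 : ∀ n → binom R n (suc n) ≈ 0#
  binom[n,1+n]≈0 n = reflexive (≡.cong (fromℕ R) (k>n⇒nCk≡0 (ℕ.n<1+n n)))

  binom[n,0]≈1 : ∀ n → binom R n 0 ≈ 1#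
  binom[n,0]≈1 n = +-identityʳ 1#

  -- Coefficientwise product of exponential generating functions; Δ differentiates one.
  infixl 7 _⋆_
  _⋆_ : Seq → Seq → Seq
  (f ⋆ g) n = Σ< (suc n) (λ j → binom R n j · (f j · g (n ∸ j)))

  Δ : Seq → Seq
  Δ f j = f (suc j)

  δ : Seq
  δ zero    = 1#
  δ (suc _) = 0#

  ⋆-leibniz : ∀ f g n → (f ⋆ g) (suc n) ≈ (Δ f ⋆ g) n + (f ⋆ Δ g) n
  ⋆-leibniz f g n = begin
      (f ⋆ g) (suc n)                              ≈⟨ Σ<-suc (suc n) T ⟩
      T 0 + Σ< (suc n) (λ j → T (suc j))           ≈⟨ +-cong refl (Σ<-cong (suc n) (λ j _ → pascal-split j)) ⟩
      T 0 + Σ< (suc n) (λ j → A j + U j)           ≈⟨ +-cong refl (Σ<-distrib-+ (suc n) A U) ⟩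
      T 0 + ((Δ f ⋆ g) n + Σ< (suc n) U)           ≈⟨ x+[y+z]≈y+[x+z] _ _ _ ⟩
      (Δ f ⋆ g) n + (T 0 + Σ< (suc n) U)           ≈⟨ +-cong refl (+-cong refl Σ<U≈Σ<V∘suc) ⟩
      (Δ f ⋆ g) n + (V 0 + Σ< n (λ i → V (suc i))) ≈⟨ +-cong refl (Σ<-suc n V) ⟨
      (Δ f ⋆ g) n + (f ⋆ Δ g) n                    ∎
    where
      T A U V : Seq
      T j = binom R (suc n) j · (f j · g (suc n ∸ j))
      A j = binom R n j · (f (suc j) · g (n ∸ j))
      U j = binom R n (suc j) · (f (suc j) · g (n ∸ j))
      V j = binom R n j · (f j · g (suc (n ∸ j)))

      pascal-split : ∀ j → T (suc j) ≈ A j + U j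
      pascal-split j = trans (*-cong (binom-pascal n j) refl) (distribʳ _ _ _)

      Σ<U≈Σ<V∘suc : Σ< (suc n) U ≈ Σ< n (λ i → V (suc i))
      Σ<U≈Σ<V∘suc = trans (+-cong (Σ<-cong n U≈V∘suc) U[n]≈0) (+-identityʳ _)
        where
          U≈V∘suc : ∀ i → i < n → U i ≈ V (suc i)
          U≈V∘suc i i<n = *-cong refl (*-cong refl (reflexive (≡.cong g (ℕ.+-∸-assoc 1 i<n))))
          U[n]≈0 : U n ≈ 0#
          U[n]≈0 = trans (*-cong (binom[n,1+n]≈0 n) refl) (zeroˡ _)

  ⋆-congˡ : ∀ f {g g′} → g ≋ g′ → f ⋆ g ≋ f ⋆ g′
  ⋆-congˡ f g≋g′ n = Σ<-cong (suc n) (λ j _ → *-cong refl (*-cong refl (g≋g′ (n ∸ j))))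

  ⋆-congʳ : ∀ g {f f′} → f ≋ f′ → f ⋆ g ≋ f′ ⋆ g
  ⋆-congʳ g f≋f′ n = Σ<-cong (suc n) (λ j _ → *-cong refl (*-cong (f≋f′ j) refl))

  ⋆-distribʳ-+ : ∀ f f′ g → (λ j → f j + f′ j) ⋆ g ≋ (λ n → (f ⋆ g) n + (f′ ⋆ g) n)
  ⋆-distribʳ-+ f f′ g n = trans (Σ<-cong (suc n) (λ j _ → trans (*-cong refl (distribʳ _ _ _)) (distribˡ _ _ _)))
                                (Σ<-distrib-+ (suc n) _ _)

  ⋆-distribˡ-+ : ∀ f g g′ → f ⋆ (λ j → g j + g′ j) ≋ (λ n → (f ⋆ g) n + (f ⋆ g′) n)
  ⋆-distribˡ-+ f g g′ n = trans (Σ<-cong (suc n) (λ j _ → trans (*-cong refl (distribˡ _ _ _)) (distribˡ _ _ _)))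
                                (Σ<-distrib-+ (suc n) _ _)

  ⋆-*ˡ : ∀ x f g → (λ j → x · f j) ⋆ g ≋ (λ n → x · (f ⋆ g) n)
  ⋆-*ˡ x f g n = trans (Σ<-cong (suc n) (λ j _ → trans (*-cong refl (*-assoc _ _ _)) (x∙yz≈y∙xz _ _ _)))
                       (sym (*-distribˡ-Σ< (suc n) x _))

  ⋆-zeroˡ : ∀ g → (λ _ → 0#) ⋆ g ≋ (λ _ → 0#)
  ⋆-zeroˡ g n = trans (Σ<-cong (suc n) (λ j _ → trans (*-cong refl (zeroˡ _)) (zeroʳ _))) (Σ<-zero (suc n))

  ⋆-at-0 : ∀ f g → (f ⋆ g) 0 ≈ f 0 · g 0
  ⋆-at-0 f g = trans (+-identityˡ _) (trans (*-cong (binom[n,0]≈1 0) refl) (*-identityˡ _))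

  ⋆-comm : ∀ f g → f ⋆ g ≋ g ⋆ f
  ⋆-comm f g zero    = trans (⋆-at-0 f g) (trans (*-comm _ _) (sym (⋆-at-0 g f)))
  ⋆-comm f g (suc n) = begin
      (f ⋆ g) (suc n)                  ≈⟨ ⋆-leibniz f g n ⟩
      (Δ f ⋆ g) n + (f ⋆ Δ g) n        ≈⟨ +-cong (⋆-comm (Δ f) g n) (⋆-comm f (Δ g) n) ⟩
      (g ⋆ Δ f) n + (Δ g ⋆ f) n        ≈⟨ +-comm _ _ ⟩
      (Δ g ⋆ f) n + (g ⋆ Δ f) n        ≈⟨ ⋆-leibniz g f n ⟨
      (g ⋆ f) (suc n)                  ∎

  ⋆-assoc : ∀ f g h → f ⋆ (g ⋆ h) ≋ (f ⋆ g) ⋆ h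
  ⋆-assoc f g h zero = begin
      (f ⋆ (g ⋆ h)) 0     ≈⟨ ⋆-at-0 f (g ⋆ h) ⟩
      f 0 · (g ⋆ h) 0     ≈⟨ *-cong refl (⋆-at-0 g h) ⟩
      f 0 · (g 0 · h 0)   ≈⟨ *-assoc _ _ _ ⟨
      (f 0 · g 0) · h 0   ≈⟨ *-cong (⋆-at-0 f g) refl ⟨
      (f ⋆ g) 0 · h 0     ≈⟨ ⋆-at-0 (f ⋆ g) h ⟨
      ((f ⋆ g) ⋆ h) 0     ∎
  ⋆-assoc f g h (suc n) = begin
      (f ⋆ (g ⋆ h)) (suc n)
        ≈⟨ ⋆-leibniz f (g ⋆ h) n ⟩
      (Δ f ⋆ (g ⋆ h)) n + (f ⋆ Δ (g ⋆ h)) n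
        ≈⟨ +-cong refl (⋆-congˡ f (⋆-leibniz g h) n) ⟩
      (Δ f ⋆ (g ⋆ h)) n + (f ⋆ (λ j → (Δ g ⋆ h) j + (g ⋆ Δ h) j)) n
        ≈⟨ +-cong refl (⋆-distribˡ-+ f (Δ g ⋆ h) (g ⋆ Δ h) n) ⟩
      (Δ f ⋆ (g ⋆ h)) n + ((f ⋆ (Δ g ⋆ h)) n + (f ⋆ (g ⋆ Δ h)) n)
        ≈⟨ +-cong (⋆-assoc (Δ f) g h n) (+-cong (⋆-assoc f (Δ g) h n) (⋆-assoc f g (Δ h) n)) ⟩
      ((Δ f ⋆ g) ⋆ h) n + (((f ⋆ Δ g) ⋆ h) n + ((f ⋆ g) ⋆ Δ h) n)
        ≈⟨ +-assoc _ _ _ ⟨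
      (((Δ f ⋆ g) ⋆ h) n + ((f ⋆ Δ g) ⋆ h) n) + ((f ⋆ g) ⋆ Δ h) n
        ≈⟨ +-cong (⋆-distribʳ-+ (Δ f ⋆ g) (f ⋆ Δ g) h n) refl ⟨
      ((λ j → (Δ f ⋆ g) j + (f ⋆ Δ g) j) ⋆ h) n + ((f ⋆ g) ⋆ Δ h) n
        ≈⟨ +-cong (⋆-congʳ h (⋆-leibniz f g) n) refl ⟨
      (Δ (f ⋆ g) ⋆ h) n + ((f ⋆ g) ⋆ Δ h) n
        ≈⟨ ⋆-leibniz (f ⋆ g) h n ⟨
      ((f ⋆ g) ⋆ h) (suc n)
        ∎

  ⋆-identityˡ : ∀ f → δ ⋆ f ≋ f
  ⋆-identityˡ f zero    = trans (⋆-at-0 δ f) (*-identityˡ _)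
  ⋆-identityˡ f (suc n) = begin
      (δ ⋆ f) (suc n)                 ≈⟨ ⋆-leibniz δ f n ⟩
      (Δ δ ⋆ f) n + (δ ⋆ Δ f) n       ≈⟨ +-cong (⋆-zeroˡ f n) (⋆-identityˡ (Δ f) n) ⟩
      0# + f (suc n)                  ≈⟨ +-identityˡ _ ⟩
      f (suc n)                       ∎

  ⋆-inverse⇒⇔ : ∀ {u v} → u ⋆ v ≋ δ → ∀ f g → (g ≋ u ⋆ f) ⇔ (f ≋ v ⋆ g)
  ⋆-inverse⇒⇔ {u} {v} u⋆v≋δ f g = mk⇔ solve unsolve
    where
      v⋆u≋δ : v ⋆ u ≋ δ
      v⋆u≋δ n = trans (⋆-comm v u n) (u⋆v≋δ n)

      solve : g ≋ u ⋆ f → f ≋ v ⋆ g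
      solve g≋u⋆f n = begin
        f n                  ≈⟨ ⋆-identityˡ f n ⟨
        (δ ⋆ f) n            ≈⟨ ⋆-congʳ f v⋆u≋δ n ⟨
        ((v ⋆ u) ⋆ f) n      ≈⟨ ⋆-assoc v u f n ⟨
        (v ⋆ (u ⋆ f)) n      ≈⟨ ⋆-congˡ v g≋u⋆f n ⟨
        (v ⋆ g) n            ∎

      unsolve : f ≋ v ⋆ g → g ≋ u ⋆ f
      unsolve f≋v⋆g n = begin
        g n                  ≈⟨ ⋆-identityˡ g n ⟨
        (δ ⋆ g) n            ≈⟨ ⋆-congʳ g u⋆v≋δ n ⟨
        ((u ⋆ v) ⋆ g) n      ≈⟨ ⋆-assoc u v g n ⟨
        (u ⋆ (v ⋆ g)) n      ≈⟨ ⋆-congˡ u f≋v⋆g n ⟨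
        (u ⋆ f) n            ∎

  χeven : Seq
  χeven zero          = 1#
  χeven (suc zero)    = 0#
  χeven (suc (suc n)) = χeven n

  χeven-2*+ : ∀ k m → χeven (2 * k ℕ.+ m) ≡ χeven m
  χeven-2*+ zero    m = ≡.refl
  χeven-2*+ (suc k) m = ≡.trans (≡.cong (λ j → χeven (j ℕ.+ m)) (ℕ.*-suc 2 k)) (χeven-2*+ k m)

  χeven-∸-2* : ∀ n k → 2 * k ≤ n → χeven (n ∸ 2 * k) ≡ χeven n
  χeven-∸-2* n k 2k≤n = ≡.trans (≡.sym (χeven-2*+ k (n ∸ 2 * k))) (≡.cong χeven (ℕ.m+[n∸m]≡n 2k≤n))

  χeven·δ≈δ : ∀ n → χeven n · δ n ≈ δ n
  χeven·δ≈δ zero    = *-identityˡ 1#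
  χeven·δ≈δ (suc n) = zeroʳ _

  Σ<-χeven : ∀ n F → Σ< (suc n) (λ j → χeven j · F j) ≈ Σ< (suc ⌊ n /2⌋) (λ k → F (2 * k))
  Σ<-χeven zero          F = +-cong refl (*-identityˡ _)
  Σ<-χeven (suc zero)    F = trans (+-cong (+-cong refl (*-identityˡ _)) (zeroˡ _)) (+-identityʳ _)
  Σ<-χeven (suc (suc m)) F = begin
      Σ< (suc (suc (suc m))) (λ j → χeven j · F j)
        ≈⟨ Σ<-suc (suc (suc m)) _ ⟩
      1# · F 0 + Σ< (suc (suc m)) (λ j → χeven (suc j) · F (suc j))
        ≈⟨ +-cong (*-identityˡ _) (Σ<-suc (suc m) _) ⟩
      F 0 + (0# · F 1 + Σ< (suc m) (λ j → χeven j · F (suc (suc j))))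
        ≈⟨ +-cong refl (trans (+-cong (zeroˡ _) refl) (+-identityˡ _)) ⟩
      F 0 + Σ< (suc m) (λ j → χeven j · F (suc (suc j)))
        ≈⟨ +-cong refl (Σ<-χeven m (λ j → F (suc (suc j)))) ⟩
      F 0 + Σ< (suc ⌊ m /2⌋) (λ k → F (suc (suc (2 * k))))
        ≈⟨ +-cong refl (Σ<-cong (suc ⌊ m /2⌋) (λ k _ → reflexive (≡.cong F (≡.sym (ℕ.*-suc 2 k))))) ⟩
      F 0 + Σ< (suc ⌊ m /2⌋) (λ k → F (2 * suc k))
        ≈⟨ Σ<-suc (suc ⌊ m /2⌋) (λ k → F (2 * k)) ⟨
      Σ< (suc (suc ⌊ m /2⌋)) (λ k → F (2 * k))
        ∎

  χeven-⋆ : ∀ g n → (χeven ⋆ g) n ≈ sum0 R ⌊ n /2⌋ (λ k → binom R n (2 * k) · g (n ∸ 2 * k))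
  χeven-⋆ g n = begin
      (χeven ⋆ g) n
        ≈⟨ Σ<-cong (suc n) (λ j _ → x∙yz≈y∙xz _ _ _) ⟩
      Σ< (suc n) (λ j → χeven j · (binom R n j · g (n ∸ j)))
        ≈⟨ Σ<-χeven n _ ⟩
      Σ< (suc ⌊ n /2⌋) (λ k → binom R n (2 * k) · g (n ∸ 2 * k))
        ≈⟨ sum0≈Σ< ⌊ n /2⌋ _ ⟨
      sum0 R ⌊ n /2⌋ (λ k → binom R n (2 * k) · g (n ∸ 2 * k))
        ∎

  χeven·-⋆ : ∀ (h g : Seq) n → ((λ j → χeven j · h j) ⋆ g) n
                        ≈ sum0 R ⌊ n /2⌋ (λ k → binom R n (2 * k) · (h (2 * k) · g (n ∸ 2 * k)))
  χeven·-⋆ h g n = begin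
      ((λ j → χeven j · h j) ⋆ g) n
        ≈⟨ Σ<-cong (suc n) (λ j _ → trans (*-cong refl (*-assoc _ _ _)) (x∙yz≈y∙xz _ _ _)) ⟩
      Σ< (suc n) (λ j → χeven j · (binom R n j · (h j · g (n ∸ j))))
        ≈⟨ Σ<-χeven n _ ⟩
      Σ< (suc ⌊ n /2⌋) (λ k → binom R n (2 * k) · (h (2 * k) · g (n ∸ 2 * k)))
        ≈⟨ sum0≈Σ< ⌊ n /2⌋ _ ⟨
      sum0 R ⌊ n /2⌋ (λ k → binom R n (2 * k) · (h (2 * k) · g (n ∸ 2 * k)))
        ∎

  a[y+s]+[1-a]y≈y+as : ∀ a y s → a · (y + s) + (1# - a) · y ≈ y + a · s
  a[y+s]+[1-a]y≈y+as a y s = begin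
      a · (y + s) + (1# - a) · y        ≈⟨ +-cong (distribˡ a y s) refl ⟩
      (a · y + a · s) + (1# - a) · y    ≈⟨ [x+y]+z≈[z+x]+y _ _ _ ⟩
      ((1# - a) · y + a · y) + a · s    ≈⟨ +-cong (distribʳ y (1# - a) a) refl ⟨
      ((1# - a) + a) · y + a · s        ≈⟨ +-cong (*-cong 1-a+a≈1 refl) refl ⟩
      1# · y + a · s                    ≈⟨ +-cong (*-identityˡ y) refl ⟩
      y + a · s                         ∎
    where
      1-a+a≈1 : (1# - a) + a ≈ 1#
      1-a+a≈1 = trans (+-assoc 1# (- a) a) (trans (+-cong refl (-‿inverseˡ a)) (+-identityʳ 1#))

  module _ (a : Carrier) where

    Etab-lookup : ∀ {t m} → t ≤ m → at R (Etab R a m) t ≡ E R a (m ∸ t)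
    Etab-lookup {t} {m} t≤m = ≡.subst (λ j → at R (Etab R a j) t ≡ E R a (m ∸ t)) (ℕ.m+[n∸m]≡n t≤m) (lookup t)
      where
        lookup : ∀ i {m} → at R (Etab R a (i ℕ.+ m)) i ≡ E R a m
        lookup zero    = ≡.refl
        lookup (suc i) = lookup i

    E-suc : ∀ m → E R a (suc m)
                  ≈ - a · sum1 R ⌊ suc m /2⌋ (λ k → binom R (suc m) (2 * k) · E R a (suc m ∸ 2 * k))
    E-suc m = *-cong refl (sum1-cong ⌊ suc m /2⌋ (λ k k< → *-cong refl (reflexive (table-entry k k<))))
      where
        table-entry : ∀ k → k < ⌊ suc m /2⌋ → at R (Etab R a m) (2 * suc k ∸ 1) ≡ E R a (suc m ∸ 2 * suc k)
        -- 2 * suc k computes to a successor, so the ∸ 1 and the suc cancel definitionally.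
        table-entry k k< = Etab-lookup (s≤s⁻¹ (k≤⌊n/2⌋⇒2*k≤n (suc m) (suc k) k<))

    E-recurrence : ∀ n → E R a n + a · sum1 R ⌊ n /2⌋ (λ k → binom R n (2 * k) · E R a (n ∸ 2 * k)) ≈ δ n
    E-recurrence zero    = trans (+-cong refl (zeroʳ a)) (+-identityʳ 1#)
    E-recurrence (suc m) = begin
        E R a (suc m) + a · S    ≈⟨ +-cong (E-suc m) refl ⟩
        - a · S + a · S          ≈⟨ distribʳ S (- a) a ⟨
        (- a + a) · S            ≈⟨ *-cong (-‿inverseˡ a) refl ⟩
        0# · S                   ≈⟨ zeroˡ S ⟩
        0#                       ∎
      where
        S : Carrier
        S = sum1 R ⌊ suc m /2⌋ (λ k → binom R (suc m) (2 * k) · E R a (suc m ∸ 2 * k))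

    -- Taylor coefficients of a cosh t + 1 − a and of its reciprocal Σₙ E_{n,a} tⁿ/n!.
    -- E_{n,a} vanishes for odd n anyway; the mask χeven just lets the even-index sums be read as convolutions.
    cosh-series : Seq
    cosh-series j = a · χeven j + (1# - a) · δ j

    E-series : Seq
    E-series j = χeven j · E R a j

    cosh-series-⋆ : ∀ f n → (cosh-series ⋆ f) n
                            ≈ a · sum0 R ⌊ n /2⌋ (λ k → binom R n (2 * k) · f (n ∸ 2 * k)) + (1# - a) · f n
    cosh-series-⋆ f n = begin
        (cosh-series ⋆ f) n
          ≈⟨ ⋆-distribʳ-+ (λ j → a · χeven j) (λ j → (1# - a) · δ j) f n ⟩
        ((λ j → a · χeven j) ⋆ f) n + ((λ j → (1# - a) · δ j) ⋆ f) n
          ≈⟨ +-cong (⋆-*ˡ a χeven f n) (⋆-*ˡ (1# - a) δ f n) ⟩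
        a · (χeven ⋆ f) n + (1# - a) · (δ ⋆ f) n
          ≈⟨ +-cong (*-cong refl (χeven-⋆ f n)) (*-cong refl (⋆-identityˡ f n)) ⟩
        a · sum0 R ⌊ n /2⌋ (λ k → binom R n (2 * k) · f (n ∸ 2 * k)) + (1# - a) · f n
          ∎

    E-series-⋆ : ∀ g n → (E-series ⋆ g) n
                         ≈ sum0 R ⌊ n /2⌋ (λ k → binom R n (2 * k) · (E R a (2 * k) · g (n ∸ 2 * k)))
    E-series-⋆ = χeven·-⋆ (E R a)

    cosh-series⋆E-series≋δ : cosh-series ⋆ E-series ≋ δ
    cosh-series⋆E-series≋δ n = begin
        (cosh-series ⋆ E-series) n
          ≈⟨ cosh-series-⋆ E-series n ⟩
        a · sum0 R ⌊ n /2⌋ (λ k → binom R n (2 * k) · E-series (n ∸ 2 * k)) + (1# - a) · (χeven n · E R a n)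
          ≈⟨ +-cong (*-cong refl even-sum) refl ⟩
        a · (χeven n · (E R a n + S)) + (1# - a) · (χeven n · E R a n)
          ≈⟨ +-cong (x∙yz≈y∙xz _ _ _) (x∙yz≈y∙xz _ _ _) ⟩
        χeven n · (a · (E R a n + S)) + χeven n · ((1# - a) · E R a n)
          ≈⟨ distribˡ _ _ _ ⟨
        χeven n · (a · (E R a n + S) + (1# - a) · E R a n)
          ≈⟨ *-cong refl (a[y+s]+[1-a]y≈y+as a _ _) ⟩
        χeven n · (E R a n + a · S)
          ≈⟨ *-cong refl (E-recurrence n) ⟩
        χeven n · δ n
          ≈⟨ χeven·δ≈δ n ⟩
        δ n
          ∎
      where
        S : Carrier
        S = sum1 R ⌊ n /2⌋ (λ k → binom R n (2 * k) · E R a (n ∸ 2 * k))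

        pull-χeven : ∀ k → k < ⌊ n /2⌋ → binom R n (2 * suc k) · E-series (n ∸ 2 * suc k)
                                         ≈ χeven n · (binom R n (2 * suc k) · E R a (n ∸ 2 * suc k))
        pull-χeven k k< = trans (*-cong refl (*-cong (reflexive χeven[n∸2k]≡χeven[n]) refl)) (x∙yz≈y∙xz _ _ _)
          where
            χeven[n∸2k]≡χeven[n] : χeven (n ∸ 2 * suc k) ≡ χeven n
            χeven[n∸2k]≡χeven[n] = χeven-∸-2* n (suc k) (k≤⌊n/2⌋⇒2*k≤n n (suc k) k<)

        even-sum : sum0 R ⌊ n /2⌋ (λ k → binom R n (2 * k) · E-series (n ∸ 2 * k)) ≈ χeven n · (E R a n + S)
        even-sum = begin
            binom R n 0 · (χeven n · E R a n) + sum1 R ⌊ n /2⌋ (λ k → binom R n (2 * k) · E-series (n ∸ 2 * k))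
              ≈⟨ +-cong (trans (*-cong (binom[n,0]≈1 n) refl) (*-identityˡ _)) (sum1-cong ⌊ n /2⌋ pull-χeven) ⟩
            χeven n · E R a n + sum1 R ⌊ n /2⌋ (λ k → χeven n · (binom R n (2 * k) · E R a (n ∸ 2 * k)))
              ≈⟨ +-cong refl (*-distribˡ-sum1 ⌊ n /2⌋ (χeven n) _) ⟨
            χeven n · E R a n + χeven n · S
              ≈⟨ distribˡ _ _ _ ⟨
            χeven n · (E R a n + S)
              ∎

  ⇔-resp-≋ : ∀ {x y f f′ g g′} → f ≋ f′ → g ≋ g′ → (x ≋ f ⇔ y ≋ g) → (x ≋ f′ ⇔ y ≋ g′)
  ⇔-resp-≋ f≋f′ g≋g′ x≋f⇔y≋g = mk⇔
      (λ x≋f′ n → trans (to (λ m → trans (x≋f′ m) (sym (f≋f′ m))) n) (g≋g′ n))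
      (λ y≋g′ n → trans (from (λ m → trans (y≋g′ m) (sym (g≋g′ m))) n) (f≋f′ n))
    where open Equivalence x≋f⇔y≋g

corollary2p3 : ∀ {c ℓ} (R : CommutativeRing c ℓ) → let open CommutativeRing R renaming (_*_ to _·_) in
    (a : Carrier) (as bs : ℕ → Carrier) →
    (∀ n → bs n ≈ (a · sum0 R ⌊ n /2⌋ (λ k → binom R n (2 * k) · as (n ∸ 2 * k)) + (1# - a) · as n))
    ⇔
    (∀ n → as n ≈ sum0 R ⌊ n /2⌋ (λ k → binom R n (2 * k) · (E R a (2 * k) · bs (n ∸ 2 * k))))
corollary2p3 R a as bs =
  ⇔-resp-≋ R (cosh-series-⋆ R a as) (E-series-⋆ R a bs)
    (⋆-inverse⇒⇔ R (cosh-series⋆E-series≋δ R a) as bs)
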